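{- Let $Y_1,Y_2,\ldots$ be i.i.d. Bernoulli$(1/2)$ and let $(Z^k)_{k\ge2}$ be generated by the bit-drop scheme (see context), independently of $Y$. Let $L^a_n(k)$ denote the length of the longest common subsequence of $Z^k$ and $Y_1\ldots Y_n$. Let $E^n_4$ be the event that $L^a_n(k)\geq 0.65k$ for all $k$ with $0.45n\le k\le n$. Then $\lim_{n\to\infty}P(E^n_4)=1$.
   Context: Bit-drop scheme: let $V_1,V_2,\ldots$ be i.i.d. Bernoulli$(1/2)$ variables and $T_3,T_4,\ldots$ independent integer variables, independent of $\{V_k\}$, with $T_{k+1}$ uniformly distributed on $\{2,\ldots,k\}$. Set $Z^2:=V_1V_2$; $Z^{k+1}$ is obtained from $Z^k=Z^k_1\ldots Z^k_k$ by inserting $V_{k+1}$ at position $T_{k+1}$, i.e. $Z^{k+1}_j=Z^k_j$ for $j<T_{k+1}$, $Z^{k+1}_{T_{k+1}}=V_{k+1}$, $Z^{k+1}_j=Z^k_{j-1}$ for $T_{k+1}<j\le k+1$. -}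

module Defs where

open import Data.Bool using (Bool; true; false; if_then_else_; _∧_; _∨_; not)
open import Data.Bool.Properties using () renaming (_≟_ to _≟ᵇ_)
open import Data.Nat using (ℕ; zero; suc; _+_; _*_; _∸_; _⊔_; _≤ᵇ_)
open import Data.List using (List; []; _∷_; _++_; map; concatMap; upTo; length)
open import Data.Integer using (+_)
open import Data.Rational using (ℚ; _/_; 0ℚ)
open import Relation.Nullary.Decidable using (does)

_==_ : Bool → Bool → Bool
a == b = does (a ≟ᵇ b)

lcs : List Bool → List Bool → ℕ
lcs [] _ = 0
lcs (_ ∷ _) [] = 0
lcs (x ∷ xs) (y ∷ ys) =
  if x == y then suc (lcs xs ys) else (lcs xs (y ∷ ys) ⊔ lcs (x ∷ xs) ys)

-- ins p x w : insert x so that it sits at (1-indexed) position p of the new word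
ins : ℕ → Bool → List Bool → List Bool
ins zero x w = x ∷ w
ins (suc zero) x w = x ∷ w
ins (suc (suc p)) x [] = x ∷ []
ins (suc (suc p)) x (y ∷ ys) = y ∷ ins (suc p) x ys

-- Bit-drop scheme: V i = V_i, T j = T_j (1-indexed); Z V T k = Z^k for k ≥ 2
Z : (ℕ → Bool) → (ℕ → ℕ) → ℕ → List Bool
Z V T zero = []
Z V T (suc zero) = []
Z V T (suc (suc zero)) = V 1 ∷ V 2 ∷ []
Z V T (suc (suc (suc k))) = ins (T (3 + k)) (V (3 + k)) (Z V T (suc (suc k)))

-- 1-indexed read of a finite list (default false / 0 outside range)
atB : List Bool → ℕ → Bool
atB [] _ = false
atB (x ∷ xs) zero = false
atB (x ∷ xs) (suc zero) = x
atB (x ∷ xs) (suc (suc i)) = atB xs (suc i)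

atN : List ℕ → ℕ → ℕ
atN [] _ = 0
atN (x ∷ _) zero = x
atN (_ ∷ xs) (suc i) = atN xs i

range : ℕ → ℕ → List ℕ
range a b = map (λ i → a + i) (upTo (suc b ∸ a))

allBits : ℕ → List (List Bool)
allBits zero = [] ∷ []
allBits (suc n) = concatMap (λ b → map (b ∷_) (allBits n)) (true ∷ false ∷ [])

-- all value lists (T_3, ..., T_{m+2}) with T_{j} ∈ {2,...,j-1}
tseqs : ℕ → List (List ℕ)
tseqs zero = [] ∷ []
tseqs (suc m) = concatMap (λ ts → map (λ t → ts ++ (t ∷ [])) (range 2 (m + 2))) (tseqs m)

-- Uniform sample space for n: (Y_1..Y_n, V_1..V_n, T_3..T_n)
record Outcome : Set where
  constructor outcome
  field
    ys : List Bool
    vs : List Bool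
    ts : List ℕ

sample : ℕ → List Outcome
sample n = concatMap (λ y → concatMap (λ v → map (outcome y v) (tseqs (n ∸ 2)))
                                       (allBits n)) (allBits n)

Zk : Outcome → ℕ → List Bool
Zk (outcome y v t) k = Z (atB v) (λ j → atN t (j ∸ 3)) k

La : Outcome → ℕ → ℕ
La o k = lcs (Zk o k) (Outcome.ys o)

allB : {A : Set} → (A → Bool) → List A → Bool
allB P [] = true
allB P (x ∷ xs) = P x ∧ allB P xs

countB : {A : Set} → (A → Bool) → List A → ℕ
countB P [] = 0
countB P (x ∷ xs) = if P x then suc (countB P xs) else countB P xs

-- E^n_4 : for all k with 0.45 n ≤ k ≤ n (and k ≥ 2, so Z^k is defined): L^a_n(k) ≥ 0.65 k
E4 : ℕ → Outcome → Bool
E4 n o = allB (λ k → not ((2 ≤ᵇ k) ∧ ((45 * n) ≤ᵇ (100 * k)))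
                     ∨ ((65 * k) ≤ᵇ (100 * La o k))) (range 0 n)

prob : {A : Set} → List A → (A → Bool) → ℚ
prob xs P with length xs
... | zero = 0ℚ
... | suc l = (+ countB P xs) / suc l

PE4 : ℕ → ℚ
PE4 n = prob (sample n) (E4 n)

{-# OPTIONS --safe #-}
-- The positions T are independent of the bits V, and inserting a fresh uniform bit at a fixed
-- position of a uniform word gives a uniform word; so Z^k is uniform on {0,1}^k and independent
-- of Y, while L^a_n(k) ≥ LCS(Z^k, Y_1 … Y_k). It therefore suffices to count the pairs (w, y) of
-- words of length k with LCS(w, y) < 0.65 k, which we do by a Chernoff bound: the moment
-- Σ_{w,y} (p/q)^(20 LCS(w,y)) is submultiplicative in k because the LCS is superadditive under
-- concatenation, and for (p, q) = (199, 200) and k = 6 a computation shows that it lies below the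
-- Markov threshold 4^6 (p/q)^78. So P(L^a_n(k) < 0.65 k) decays geometrically in k, and a union
-- bound over the at most n + 1 values k ≥ 0.45 n tends to 0.
module Submission where

open import Defs
open import Data.Nat using (ℕ; zero; suc; _≤_)
open import Data.Product using (∃-syntax; _,_)
open import Data.Empty using (⊥-elim)

module Counting where

  open import Data.Bool using (Bool; true; false; if_then_else_; _∧_; _∨_; not; T)
  open import Data.Nat
  open import Data.Nat.Properties
  open import Algebra.Properties.CommutativeSemigroup +-commutativeSemigroup
    using () renaming (interchange to +-interchange)
  open import Algebra.Properties.CommutativeSemigroup *-commutativeSemigroup
    using () renaming (interchange to *-interchange)
  open import Data.Nat.DivMod using (_/_; _%_; m≡m%n+[m/n]*n; m%n<n; m/n*n≤m; m*n/n≡m; /-monoˡ-≤)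
  open import Data.Nat.Tactic.RingSolver using (solve-∀)
  open import Data.List using (List; []; _∷_; _++_; map; concatMap; length; upTo)
  open import Data.List.Properties using (length-++; ++-identityʳ; length-map; length-upTo)
  open import Data.List.Relation.Unary.All using (All; []; _∷_)
  import Data.List.Relation.Unary.All as All using (map)
  import Data.List.Relation.Unary.All.Properties as All using (++⁺; map⁺; applyUpTo⁺₁)
  open import Data.List.Relation.Binary.Sublist.Propositional using (_⊆_; []; _∷_; _∷ʳ_; minimum)
  open import Data.List.Relation.Binary.Sublist.Propositional.Properties using (∷ˡ⁻; ++⁺; ++⁺ʳ; length-mono-≤)
  open import Data.Product using (_×_; proj₁; proj₂)
  open import Data.Sum using (inj₁; inj₂)
  open import Data.Unit using (tt)
  open import Relation.Binary.PropositionalEquality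
  open import Relation.Nullary using (contradiction)

  ∑ : {A : Set} → List A → (A → ℕ) → ℕ
  ∑ [] f = 0
  ∑ (x ∷ xs) f = f x + ∑ xs f

  syntax ∑ xs (λ x → e) = ∑[ x ∈ xs ] e

  module _ {A : Set} where

    ∑-++ : (xs ys : List A) (f : A → ℕ) → ∑ (xs ++ ys) f ≡ ∑ xs f + ∑ ys f
    ∑-++ [] ys f = refl
    ∑-++ (x ∷ xs) ys f rewrite ∑-++ xs ys f = sym (+-assoc (f x) (∑ xs f) (∑ ys f))

    ∑-cong : (xs : List A) {f g : A → ℕ} → (∀ x → f x ≡ g x) → ∑ xs f ≡ ∑ xs g
    ∑-cong [] e = refl
    ∑-cong (x ∷ xs) e = cong₂ _+_ (e x) (∑-cong xs e)

    ∑-cong-All : {P : A → Set} {xs : List A} {f g : A → ℕ} →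
                 All P xs → (∀ {x} → P x → f x ≡ g x) → ∑ xs f ≡ ∑ xs g
    ∑-cong-All [] e = refl
    ∑-cong-All (px ∷ pxs) e = cong₂ _+_ (e px) (∑-cong-All pxs e)

    ∑-mono : (xs : List A) {f g : A → ℕ} → (∀ x → f x ≤ g x) → ∑ xs f ≤ ∑ xs g
    ∑-mono [] e = z≤n
    ∑-mono (x ∷ xs) e = +-mono-≤ (e x) (∑-mono xs e)

    ∑-mono-All : {P : A → Set} {xs : List A} {f g : A → ℕ} →
                 All P xs → (∀ {x} → P x → f x ≤ g x) → ∑ xs f ≤ ∑ xs g
    ∑-mono-All [] e = z≤n
    ∑-mono-All (px ∷ pxs) e = +-mono-≤ (e px) (∑-mono-All pxs e)

    ∑-const : (xs : List A) (c : ℕ) → ∑[ _ ∈ xs ] c ≡ length xs * c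
    ∑-const [] c = refl
    ∑-const (x ∷ xs) c = cong (c +_) (∑-const xs c)

    length≡∑1 : (xs : List A) → length xs ≡ ∑[ _ ∈ xs ] 1
    length≡∑1 xs = sym (trans (∑-const xs 1) (*-identityʳ (length xs)))

    ∑-*ˡ : (xs : List A) (c : ℕ) (f : A → ℕ) → ∑[ x ∈ xs ] (c * f x) ≡ c * ∑ xs f
    ∑-*ˡ [] c f = sym (*-zeroʳ c)
    ∑-*ˡ (x ∷ xs) c f rewrite ∑-*ˡ xs c f = sym (*-distribˡ-+ c (f x) (∑ xs f))

    ∑-*ʳ : (xs : List A) (c : ℕ) (f : A → ℕ) → ∑[ x ∈ xs ] (f x * c) ≡ ∑ xs f * c
    ∑-*ʳ [] c f = refl
    ∑-*ʳ (x ∷ xs) c f rewrite ∑-*ʳ xs c f = sym (*-distribʳ-+ c (f x) (∑ xs f))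

    ∑-distrib-+ : (xs : List A) (f g : A → ℕ) → ∑[ x ∈ xs ] (f x + g x) ≡ ∑ xs f + ∑ xs g
    ∑-distrib-+ [] f g = refl
    ∑-distrib-+ (x ∷ xs) f g rewrite ∑-distrib-+ xs f g = +-interchange (f x) (g x) (∑ xs f) (∑ xs g)

    ∑-zero : (xs : List A) → ∑[ _ ∈ xs ] 0 ≡ 0
    ∑-zero [] = refl
    ∑-zero (x ∷ xs) = ∑-zero xs

  module _ {A B : Set} where

    ∑-map : (g : A → B) (xs : List A) (f : B → ℕ) → ∑ (map g xs) f ≡ ∑[ x ∈ xs ] f (g x)
    ∑-map g [] f = refl
    ∑-map g (x ∷ xs) f = cong (f (g x) +_) (∑-map g xs f)

    ∑-concatMap : (g : A → List B) (xs : List A) (f : B → ℕ) →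
                  ∑ (concatMap g xs) f ≡ ∑[ x ∈ xs ] ∑ (g x) f
    ∑-concatMap g [] f = refl
    ∑-concatMap g (x ∷ xs) f =
      trans (∑-++ (g x) (concatMap g xs) f) (cong (∑ (g x) f +_) (∑-concatMap g xs f))

    ∑-comm : (xs : List A) (ys : List B) (f : A → B → ℕ) →
             ∑[ x ∈ xs ] ∑[ y ∈ ys ] f x y ≡ ∑[ y ∈ ys ] ∑[ x ∈ xs ] f x y
    ∑-comm [] ys f = sym (∑-zero ys)
    ∑-comm (x ∷ xs) ys f rewrite ∑-comm xs ys f =
      sym (∑-distrib-+ ys (f x) (λ y → ∑[ x ∈ xs ] f x y))

  ∑-product : {A B C D : Set} (as : List A) (bs : List B) (cs : List C) (ds : List D)
              (f : A → C → ℕ) (g : B → D → ℕ) →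
              ∑[ a ∈ as ] ∑[ b ∈ bs ] ∑[ c ∈ cs ] ∑[ d ∈ ds ] (f a c * g b d)
              ≡ (∑[ a ∈ as ] ∑[ c ∈ cs ] f a c) * (∑[ b ∈ bs ] ∑[ d ∈ ds ] g b d)
  ∑-product as bs cs ds f g = begin
      ∑[ a ∈ as ] ∑[ b ∈ bs ] ∑[ c ∈ cs ] ∑[ d ∈ ds ] (f a c * g b d)
    ≡⟨ ∑-cong as (λ a → ∑-cong bs (λ b → ∑-cong cs (λ c → ∑-*ˡ ds (f a c) (g b)))) ⟩
      ∑[ a ∈ as ] ∑[ b ∈ bs ] ∑[ c ∈ cs ] (f a c * G b)
    ≡⟨ ∑-cong as (λ a → ∑-cong bs (λ b → ∑-*ʳ cs (G b) (f a))) ⟩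
      ∑[ a ∈ as ] ∑[ b ∈ bs ] (F a * G b)
    ≡⟨ ∑-cong as (λ a → ∑-*ˡ bs (F a) G) ⟩
      ∑[ a ∈ as ] (F a * ∑ bs G)
    ≡⟨ ∑-*ʳ as (∑ bs G) F ⟩
      ∑ as F * ∑ bs G ∎
    where
    open ≡-Reasoning
    F : _ → ℕ
    F a = ∑[ c ∈ cs ] f a c
    G : _ → ℕ
    G b = ∑[ d ∈ ds ] g b d

  allBits-length : ∀ k → All (λ u → length u ≡ k) (allBits k)
  allBits-length zero = refl ∷ []
  allBits-length (suc k) = All.++⁺ (prefixed true) (All.++⁺ (prefixed false) [])
    where
    prefixed : ∀ b → All (λ u → length u ≡ suc k) (map (b ∷_) (allBits k))
    prefixed b = All.map⁺ (All.map (cong suc) (allBits-length k))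

  ∑-allBits-cong : ∀ k {f g : List Bool → ℕ} →
                   (∀ u → length u ≡ k → f u ≡ g u) → ∑ (allBits k) f ≡ ∑ (allBits k) g
  ∑-allBits-cong k e = ∑-cong-All (allBits-length k) (e _)

  ∑-allBits-mono : ∀ k {f g : List Bool → ℕ} →
                   (∀ u → length u ≡ k → f u ≤ g u) → ∑ (allBits k) f ≤ ∑ (allBits k) g
  ∑-allBits-mono k e = ∑-mono-All (allBits-length k) (e _)

  ∑-allBits-suc : ∀ k (f : List Bool → ℕ) →
    ∑ (allBits (suc k)) f ≡ ∑[ u ∈ allBits k ] f (true ∷ u) + ∑[ u ∈ allBits k ] f (false ∷ u)
  ∑-allBits-suc k f = begin
      ∑ (map (true ∷_) (allBits k) ++ (map (false ∷_) (allBits k) ++ [])) f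
    ≡⟨ ∑-++ (map (true ∷_) (allBits k)) _ f ⟩
      ∑ (map (true ∷_) (allBits k)) f + ∑ (map (false ∷_) (allBits k) ++ []) f
    ≡⟨ cong₂ _+_ (∑-map (true ∷_) (allBits k) f)
                 (trans (cong (λ us → ∑ us f) (++-identityʳ (map (false ∷_) (allBits k)))) (∑-map (false ∷_) (allBits k) f)) ⟩
      ∑[ u ∈ allBits k ] f (true ∷ u) + ∑[ u ∈ allBits k ] f (false ∷ u) ∎
    where open ≡-Reasoning

  ∑-allBits-+ : ∀ k m (f : List Bool → ℕ) →
    ∑ (allBits (k + m)) f ≡ ∑[ u ∈ allBits k ] ∑[ s ∈ allBits m ] f (u ++ s)
  ∑-allBits-+ zero m f = sym (+-identityʳ _)
  ∑-allBits-+ (suc k) m f = begin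
      ∑ (allBits (suc (k + m))) f
    ≡⟨ ∑-allBits-suc (k + m) f ⟩
      ∑[ u ∈ allBits (k + m) ] f (true ∷ u) + ∑[ u ∈ allBits (k + m) ] f (false ∷ u)
    ≡⟨ cong₂ _+_ (∑-allBits-+ k m (λ u → f (true ∷ u))) (∑-allBits-+ k m (λ u → f (false ∷ u))) ⟩
      _
    ≡⟨ sym (∑-allBits-suc k (λ u → ∑[ s ∈ allBits m ] f (u ++ s))) ⟩
      ∑[ u ∈ allBits (suc k) ] ∑[ s ∈ allBits m ] f (u ++ s) ∎
    where open ≡-Reasoning

  ∑-allBits-snoc : ∀ k (f : List Bool → ℕ) →
    ∑ (allBits (suc k)) f ≡ ∑[ u ∈ allBits k ] (f (u ++ true ∷ []) + f (u ++ false ∷ []))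
  ∑-allBits-snoc k f = begin
      ∑ (allBits (suc k)) f
    ≡⟨ cong (λ l → ∑ (allBits l) f) (+-comm 1 k) ⟩
      ∑ (allBits (k + 1)) f
    ≡⟨ ∑-allBits-+ k 1 f ⟩
      ∑[ u ∈ allBits k ] (f (u ++ true ∷ []) + (f (u ++ false ∷ []) + 0))
    ≡⟨ ∑-cong (allBits k) (λ u → cong (f (u ++ true ∷ []) +_) (+-identityʳ _)) ⟩
      ∑[ u ∈ allBits k ] (f (u ++ true ∷ []) + f (u ++ false ∷ [])) ∎
    where open ≡-Reasoning

  ∑-allBits-const : ∀ m c → ∑[ _ ∈ allBits m ] c ≡ 2 ^ m * c
  ∑-allBits-const zero c = refl
  ∑-allBits-const (suc m) c =
    trans (∑-allBits-suc m (λ _ → c)) (trans (cong₂ _+_ IH IH) (double (2 ^ m) c))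
    where
    IH : ∑[ _ ∈ allBits m ] c ≡ 2 ^ m * c
    IH = ∑-allBits-const m c
    double : ∀ a c → a * c + a * c ≡ 2 * a * c
    double = solve-∀

  ∑-allBits-ins : ∀ k p (f : List Bool → ℕ) →
    ∑[ w ∈ allBits k ] (f (ins p true w) + f (ins p false w)) ≡ ∑ (allBits (suc k)) f
  ∑-allBits-ins k zero f =
    trans (∑-distrib-+ (allBits k) _ _) (sym (∑-allBits-suc k f))
  ∑-allBits-ins k (suc zero) f =
    trans (∑-distrib-+ (allBits k) _ _) (sym (∑-allBits-suc k f))
  ∑-allBits-ins zero (suc (suc p)) f =
    trans (+-identityʳ _) (cong (f (true ∷ []) +_) (sym (+-identityʳ _)))
  ∑-allBits-ins (suc k) (suc (suc p)) f = begin
      ∑[ w ∈ allBits (suc k) ] (f (ins (2 + p) true w) + f (ins (2 + p) false w))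
    ≡⟨ ∑-allBits-suc k _ ⟩
      ∑[ w ∈ allBits k ] (f (true ∷ ins (suc p) true w) + f (true ∷ ins (suc p) false w))
        + ∑[ w ∈ allBits k ] (f (false ∷ ins (suc p) true w) + f (false ∷ ins (suc p) false w))
    ≡⟨ cong₂ _+_ (∑-allBits-ins k (suc p) (λ w → f (true ∷ w)))
                 (∑-allBits-ins k (suc p) (λ w → f (false ∷ w))) ⟩
      ∑[ w ∈ allBits (suc k) ] f (true ∷ w) + ∑[ w ∈ allBits (suc k) ] f (false ∷ w)
    ≡⟨ sym (∑-allBits-suc (suc k) f) ⟩
      ∑ (allBits (2 + k)) f ∎
    where open ≡-Reasoning

  Z-cong : ∀ {V V′ : ℕ → Bool} T k → (∀ j → j ≤ k → V j ≡ V′ j) → Z V T k ≡ Z V′ T k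
  Z-cong T zero e = refl
  Z-cong T (suc zero) e = refl
  Z-cong T (suc (suc zero)) e = cong₂ (λ a b → a ∷ b ∷ []) (e 1 (s≤s z≤n)) (e 2 ≤-refl)
  Z-cong T (suc (suc (suc k))) e =
    cong₂ (ins (T (3 + k))) (e (3 + k) ≤-refl) (Z-cong T (suc (suc k)) (λ j j≤ → e j (m≤n⇒m≤1+n j≤)))

  atB-++ : ∀ u s {j} → j ≤ length u → atB (u ++ s) j ≡ atB u j
  atB-++ [] [] z≤n = refl
  atB-++ [] (_ ∷ _) z≤n = refl
  atB-++ (x ∷ u) s {zero} _ = refl
  atB-++ (x ∷ u) s {suc zero} _ = refl
  atB-++ (x ∷ u) s {suc (suc j)} (s≤s j≤) = atB-++ u s j≤

  atB-snoc : ∀ u b → atB (u ++ b ∷ []) (suc (length u)) ≡ b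
  atB-snoc [] b = refl
  atB-snoc (x ∷ u) b = atB-snoc u b

  Z-extend : ∀ T k u s → length u ≡ k → Z (atB (u ++ s)) T k ≡ Z (atB u) T k
  Z-extend T k u s refl = Z-cong T k (λ j j≤ → atB-++ u s j≤)

  -- Z^(k+1) inserts the last bit of V into Z^k, and insertion at a fixed position
  -- is a bijection {0,1}^k × {0,1} ≅ {0,1}^(k+1).
  ∑-Z-uniform : ∀ k T (f : List Bool → ℕ) →
    ∑[ u ∈ allBits (2 + k) ] f (Z (atB u) T (2 + k)) ≡ ∑ (allBits (2 + k)) f
  ∑-Z-uniform zero T f = refl
  ∑-Z-uniform (suc k) T f = begin
      ∑[ u ∈ allBits (3 + k) ] f (Z (atB u) T (3 + k))
    ≡⟨ ∑-allBits-snoc (2 + k) _ ⟩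
      ∑[ u ∈ allBits (2 + k) ] (f (Z (atB (u ++ true ∷ [])) T (3 + k))
                                + f (Z (atB (u ++ false ∷ [])) T (3 + k)))
    ≡⟨ ∑-allBits-cong (2 + k) (λ u e → cong₂ _+_ (cong f (Z-snoc u true e)) (cong f (Z-snoc u false e))) ⟩
      ∑[ u ∈ allBits (2 + k) ] insertions (Z (atB u) T (2 + k))
    ≡⟨ ∑-Z-uniform k T insertions ⟩
      ∑ (allBits (2 + k)) insertions
    ≡⟨ ∑-allBits-ins (2 + k) (T (3 + k)) f ⟩
      ∑ (allBits (3 + k)) f ∎
    where
    open ≡-Reasoning
    insertions : List Bool → ℕ
    insertions w = f (ins (T (3 + k)) true w) + f (ins (T (3 + k)) false w)
    Z-snoc : ∀ u b → length u ≡ 2 + k →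
             Z (atB (u ++ b ∷ [])) T (3 + k) ≡ ins (T (3 + k)) b (Z (atB u) T (2 + k))
    Z-snoc u b e = cong₂ (ins (T (3 + k)))
      (subst (λ l → atB (u ++ b ∷ []) (suc l) ≡ b) e (atB-snoc u b)) (Z-extend T (2 + k) u (b ∷ []) e)

  ∑-Z : ∀ T k n (f : List Bool → ℕ) → 2 ≤ k → k ≤ n →
    ∑[ v ∈ allBits n ] f (Z (atB v) T k) ≡ 2 ^ (n ∸ k) * ∑ (allBits k) f
  ∑-Z T k@(suc (suc k′)) n f (s≤s (s≤s z≤n)) k≤n = begin
      ∑[ v ∈ allBits n ] f (Z (atB v) T k)
    ≡⟨ cong (λ l → ∑[ v ∈ allBits l ] f (Z (atB v) T k)) (sym (m+[n∸m]≡n k≤n)) ⟩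
      ∑[ v ∈ allBits (k + (n ∸ k)) ] f (Z (atB v) T k)
    ≡⟨ ∑-allBits-+ k (n ∸ k) _ ⟩
      ∑[ u ∈ allBits k ] ∑[ s ∈ allBits (n ∸ k) ] f (Z (atB (u ++ s)) T k)
    ≡⟨ ∑-allBits-cong k (λ u e → trans (∑-cong (allBits (n ∸ k)) (λ s → cong f (Z-extend T k u s e)))
                                       (∑-allBits-const (n ∸ k) _)) ⟩
      ∑[ u ∈ allBits k ] (2 ^ (n ∸ k) * f (Z (atB u) T k))
    ≡⟨ ∑-*ˡ (allBits k) (2 ^ (n ∸ k)) _ ⟩
      2 ^ (n ∸ k) * ∑[ u ∈ allBits k ] f (Z (atB u) T k)
    ≡⟨ cong (2 ^ (n ∸ k) *_) (∑-Z-uniform k′ T f) ⟩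
      2 ^ (n ∸ k) * ∑ (allBits k) f ∎
    where open ≡-Reasoning

  CommonSubseq : List Bool → List Bool → ℕ → Set
  CommonSubseq x y n = ∃[ s ] (s ⊆ x × s ⊆ y × length s ≡ n)

  private
    lcs-maximal-∷-≡ : ∀ {a x y s} → (∀ {t} → t ⊆ x → t ⊆ y → length t ≤ lcs x y) →
                      s ⊆ a ∷ x → s ⊆ a ∷ y → length s ≤ suc (lcs x y)
    lcs-maximal-∷-≡ IH (_ ∷ʳ p) (_ ∷ʳ q) = m≤n⇒m≤1+n (IH p q)
    lcs-maximal-∷-≡ IH (_ ∷ʳ p) (refl ∷ q) = s≤s (IH (∷ˡ⁻ p) q)
    lcs-maximal-∷-≡ IH (refl ∷ p) (_ ∷ʳ q) = s≤s (IH p (∷ˡ⁻ q))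
    lcs-maximal-∷-≡ IH (refl ∷ p) (refl ∷ q) = s≤s (IH p q)

    lcs-maximal-∷-≢ : ∀ {a b x y s} →
      (∀ {t} → t ⊆ x → t ⊆ b ∷ y → length t ≤ lcs x (b ∷ y)) →
      (∀ {t} → t ⊆ a ∷ x → t ⊆ y → length t ≤ lcs (a ∷ x) y) → a ≢ b →
      s ⊆ a ∷ x → s ⊆ b ∷ y → length s ≤ lcs x (b ∷ y) ⊔ lcs (a ∷ x) y
    lcs-maximal-∷-≢ IH₁ IH₂ a≢b (_ ∷ʳ p) q = ≤-trans (IH₁ p q) (m≤m⊔n _ _)
    lcs-maximal-∷-≢ IH₁ IH₂ a≢b (refl ∷ p) (_ ∷ʳ q) = ≤-trans (IH₂ (refl ∷ p) q) (m≤n⊔m _ _)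
    lcs-maximal-∷-≢ IH₁ IH₂ a≢b (refl ∷ p) (refl ∷ q) = contradiction refl a≢b

    common-∷-≢ : ∀ {a b x y m n} → CommonSubseq x (b ∷ y) m → CommonSubseq (a ∷ x) y n →
                 CommonSubseq (a ∷ x) (b ∷ y) (m ⊔ n)
    common-∷-≢ {m = m} {n} (s , p , q , e) (t , p′ , q′ , e′) with ≤-total m n
    ... | inj₁ m≤n = t , p′ , _ ∷ʳ q′ , trans e′ (sym (m≤n⇒m⊔n≡n m≤n))
    ... | inj₂ n≤m = s , _ ∷ʳ p , q , trans e (sym (m≥n⇒m⊔n≡m n≤m))

  lcs-maximal : ∀ x y {s} → s ⊆ x → s ⊆ y → length s ≤ lcs x y
  lcs-maximal [] y [] q = z≤n
  lcs-maximal (a ∷ x) [] p [] = z≤n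
  lcs-maximal (true ∷ x) (true ∷ y) = lcs-maximal-∷-≡ (lcs-maximal x y)
  lcs-maximal (false ∷ x) (false ∷ y) = lcs-maximal-∷-≡ (lcs-maximal x y)
  lcs-maximal (true ∷ x) (false ∷ y) =
    lcs-maximal-∷-≢ (lcs-maximal x (false ∷ y)) (lcs-maximal (true ∷ x) y) (λ ())
  lcs-maximal (false ∷ x) (true ∷ y) =
    lcs-maximal-∷-≢ (lcs-maximal x (true ∷ y)) (lcs-maximal (false ∷ x) y) (λ ())

  lcs-common : ∀ x y → CommonSubseq x y (lcs x y)
  lcs-common [] y = [] , [] , minimum y , refl
  lcs-common (a ∷ x) [] = [] , minimum (a ∷ x) , [] , refl
  lcs-common (true ∷ x) (true ∷ y) with lcs-common x y
  ... | s , p , q , e = true ∷ s , refl ∷ p , refl ∷ q , cong suc e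
  lcs-common (false ∷ x) (false ∷ y) with lcs-common x y
  ... | s , p , q , e = false ∷ s , refl ∷ p , refl ∷ q , cong suc e
  lcs-common (true ∷ x) (false ∷ y) = common-∷-≢ (lcs-common x (false ∷ y)) (lcs-common (true ∷ x) y)
  lcs-common (false ∷ x) (true ∷ y) = common-∷-≢ (lcs-common x (true ∷ y)) (lcs-common (false ∷ x) y)

  lcs≤length : ∀ x y → lcs x y ≤ length x
  lcs≤length x y with lcs-common x y
  ... | s , p , _ , e = subst (_≤ length x) e (length-mono-≤ p)

  lcs-superadditive : ∀ a b c d → lcs a c + lcs b d ≤ lcs (a ++ b) (c ++ d)
  lcs-superadditive a b c d with lcs-common a c | lcs-common b d
  ... | s , p , q , e | s′ , p′ , q′ , e′ =
    subst (_≤ lcs (a ++ b) (c ++ d)) (trans (length-++ s) (cong₂ _+_ e e′))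
      (lcs-maximal (a ++ b) (c ++ d) (++⁺ p p′) (++⁺ q q′))

  lcs-monoʳ-++ : ∀ a c d → lcs a c ≤ lcs a (c ++ d)
  lcs-monoʳ-++ a c d with lcs-common a c
  ... | s , p , q , e = subst (_≤ lcs a (c ++ d)) e (lcs-maximal a (c ++ d) p (++⁺ʳ d q))

  ≤ᵇ≡true⇒≤ : ∀ m n → (m ≤ᵇ n) ≡ true → m ≤ n
  ≤ᵇ≡true⇒≤ m n m≤ᵇn = ≤ᵇ⇒≤ m n (subst T (sym m≤ᵇn) tt)

  ≤ᵇ≡false⇒> : ∀ m n → (m ≤ᵇ n) ≡ false → n < m
  ≤ᵇ≡false⇒> m n m≰ᵇn = ≰⇒> (λ m≤n → subst T m≰ᵇn (≤⇒≤ᵇ m≤n))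

  isLong : ℕ → ℕ → Bool
  isLong k L = 65 * k ≤ᵇ 100 * L

  miss : Bool → ℕ
  miss b = if b then 0 else 1

  failures : ℕ → ℕ
  failures k = ∑[ w ∈ allBits k ] ∑[ y ∈ allBits k ] miss (isLong k (lcs w y))

  [m*n]^k≡m^k*n^k : ∀ m n k → (m * n) ^ k ≡ m ^ k * n ^ k
  [m*n]^k≡m^k*n^k m n zero = refl
  [m*n]^k≡m^k*n^k m n (suc k) rewrite [m*n]^k≡m^k*n^k m n k = *-interchange m n (m ^ k) (n ^ k)

  [m^n]^o≡m^[o*n] : ∀ m n o → (m ^ n) ^ o ≡ m ^ (o * n)
  [m^n]^o≡m^[o*n] m n o = trans (^-*-assoc m n o) (cong (m ^_) (*-comm n o))

  ^*^-shift-≤ : ∀ {x y} a b a′ b′ → x ≤ y → a′ ≤ a → a + b ≡ a′ + b′ →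
                x ^ a * y ^ b ≤ x ^ a′ * y ^ b′
  ^*^-shift-≤ {x} {y} a b a′ b′ x≤y a′≤a a+b≡a′+b′ = begin
      x ^ a * y ^ b
    ≡⟨ cong (λ c → x ^ c * y ^ b) (sym (m+[n∸m]≡n a′≤a)) ⟩
      x ^ (a′ + d) * y ^ b
    ≡⟨ cong (_* y ^ b) (^-distribˡ-+-* x a′ d) ⟩
      x ^ a′ * x ^ d * y ^ b
    ≤⟨ *-monoˡ-≤ (y ^ b) (*-monoʳ-≤ (x ^ a′) (^-monoˡ-≤ d x≤y)) ⟩
      x ^ a′ * y ^ d * y ^ b
    ≡⟨ *-assoc (x ^ a′) (y ^ d) (y ^ b) ⟩
      x ^ a′ * (y ^ d * y ^ b)
    ≡⟨ cong (x ^ a′ *_) (sym (^-distribˡ-+-* y d b)) ⟩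
      x ^ a′ * y ^ (d + b)
    ≡⟨ cong (λ c → x ^ a′ * y ^ c) d+b≡b′ ⟩
      x ^ a′ * y ^ b′ ∎
    where
    open ≤-Reasoning
    d : ℕ
    d = a ∸ a′
    d+b≡b′ : d + b ≡ b′
    d+b≡b′ = +-cancelˡ-≡ a′ _ _ (begin-equality
      a′ + (d + b)  ≡⟨ sym (+-assoc a′ d b) ⟩
      a′ + d + b    ≡⟨ cong (_+ b) (m+[n∸m]≡n a′≤a) ⟩
      a + b         ≡⟨ a+b≡a′+b′ ⟩
      a′ + b′       ∎)

  miss-isLong-antitone : ∀ k {L L′} → L ≤ L′ → miss (isLong k L′) ≤ miss (isLong k L)
  miss-isLong-antitone k {L} {L′} L≤L′ with isLong k L in long | isLong k L′ in long′
  ... | _ | true = z≤n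
  ... | false | false = ≤-refl
  ... | true | false =
    contradiction (≤-trans (≤ᵇ≡true⇒≤ (65 * k) (100 * L) long) (*-monoʳ-≤ 100 L≤L′))
                  (<⇒≱ (≤ᵇ≡false⇒> (65 * k) (100 * L′) long′))

  ∑-miss-prefix : ∀ {k n} w → k ≤ n →
    ∑[ y ∈ allBits n ] miss (isLong k (lcs w y)) ≤ 2 ^ (n ∸ k) * ∑[ y ∈ allBits k ] miss (isLong k (lcs w y))
  ∑-miss-prefix {k} {n} w k≤n = begin
      ∑[ y ∈ allBits n ] short y
    ≡⟨ cong (λ l → ∑[ y ∈ allBits l ] short y) (sym (m+[n∸m]≡n k≤n)) ⟩
      ∑[ y ∈ allBits (k + (n ∸ k)) ] short y
    ≡⟨ ∑-allBits-+ k (n ∸ k) short ⟩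
      ∑[ y ∈ allBits k ] ∑[ s ∈ allBits (n ∸ k) ] short (y ++ s)
    ≤⟨ ∑-mono (allBits k) (λ y → ∑-mono (allBits (n ∸ k)) (λ s →
         miss-isLong-antitone k (lcs-monoʳ-++ w y s))) ⟩
      ∑[ y ∈ allBits k ] ∑[ s ∈ allBits (n ∸ k) ] short y
    ≡⟨ ∑-cong (allBits k) (λ y → ∑-allBits-const (n ∸ k) (short y)) ⟩
      ∑[ y ∈ allBits k ] (2 ^ (n ∸ k) * short y)
    ≡⟨ ∑-*ˡ (allBits k) (2 ^ (n ∸ k)) short ⟩
      2 ^ (n ∸ k) * ∑[ y ∈ allBits k ] short y ∎
    where
    open ≤-Reasoning
    short : List Bool → ℕ
    short y = miss (isLong k (lcs w y))

  range-bounded : ∀ n → All (_≤ n) (range 0 n)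
  range-bounded n = All.map⁺ (All.applyUpTo⁺₁ (λ i → i) (suc n) ≤-pred)

  length-range : ∀ a b → length (range a b) ≡ suc b ∸ a
  length-range a b = trans (length-map (a +_) (upTo (suc b ∸ a))) (length-upTo (suc b ∸ a))

  ∑-sample : ∀ n (f : Outcome → ℕ) →
    ∑ (sample n) f ≡ ∑[ y ∈ allBits n ] ∑[ v ∈ allBits n ] ∑[ t ∈ tseqs (n ∸ 2) ] f (outcome y v t)
  ∑-sample n f =
    trans (∑-concatMap _ (allBits n) f) (∑-cong (allBits n) (λ y →
    trans (∑-concatMap _ (allBits n) f) (∑-cong (allBits n) (λ v → ∑-map (outcome y v) (tseqs (n ∸ 2)) f))))

  length-sample : ∀ n → length (sample n) ≡ 4 ^ n * length (tseqs (n ∸ 2))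
  length-sample n = begin
      length (sample n)
    ≡⟨ length≡∑1 (sample n) ⟩
      ∑[ _ ∈ sample n ] 1
    ≡⟨ ∑-sample n (λ _ → 1) ⟩
      ∑[ _ ∈ allBits n ] ∑[ _ ∈ allBits n ] ∑[ _ ∈ tseqs (n ∸ 2) ] 1
    ≡⟨ ∑-cong (allBits n) (λ _ → ∑-cong (allBits n) (λ _ → sym (length≡∑1 (tseqs (n ∸ 2))))) ⟩
      ∑[ _ ∈ allBits n ] ∑[ _ ∈ allBits n ] (length (tseqs (n ∸ 2)))
    ≡⟨ trans (∑-cong (allBits n) (λ _ → ∑-allBits-const n _)) (∑-allBits-const n _) ⟩
      2 ^ n * (2 ^ n * length (tseqs (n ∸ 2)))
    ≡⟨ trans (sym (*-assoc (2 ^ n) _ _)) (cong (_* length (tseqs (n ∸ 2))) (sym ([m*n]^k≡m^k*n^k 2 2 n))) ⟩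
      4 ^ n * length (tseqs (n ∸ 2)) ∎
    where open ≡-Reasoning

  length-tseqs : ∀ m → length (tseqs m) ≡ m !
  length-tseqs zero = refl
  length-tseqs (suc m) = begin
      length (tseqs (suc m))
    ≡⟨ length≡∑1 (tseqs (suc m)) ⟩
      ∑[ _ ∈ tseqs (suc m) ] 1
    ≡⟨ ∑-concatMap _ (tseqs m) (λ _ → 1) ⟩
      ∑[ ts ∈ tseqs m ] ∑[ _ ∈ map (λ t → ts ++ t ∷ []) (range 2 (m + 2)) ] 1
    ≡⟨ ∑-cong (tseqs m) (λ ts → trans (∑-map _ (range 2 (m + 2)) (λ _ → 1)) (sym (length≡∑1 (range 2 (m + 2))))) ⟩
      ∑[ _ ∈ tseqs m ] length (range 2 (m + 2))
    ≡⟨ ∑-const (tseqs m) _ ⟩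
      length (tseqs m) * length (range 2 (m + 2))
    ≡⟨ cong₂ _*_ (length-tseqs m) (trans (length-range 2 (m + 2)) (m+n∸n≡m (suc m) 2)) ⟩
      m ! * suc m
    ≡⟨ *-comm (m !) (suc m) ⟩
      suc m ! ∎
    where open ≡-Reasoning

  ∑-sample-Zk : ∀ {k n} (f : List Bool → List Bool → ℕ) → 2 ≤ k → k ≤ n →
    ∑[ o ∈ sample n ] f (Zk o k) (Outcome.ys o)
    ≡ length (tseqs (n ∸ 2)) * (2 ^ (n ∸ k) * ∑[ w ∈ allBits k ] ∑[ y ∈ allBits n ] f w y)
  ∑-sample-Zk {k} {n} f 2≤k k≤n = begin
      ∑[ o ∈ sample n ] f (Zk o k) (Outcome.ys o)
    ≡⟨ ∑-sample n _ ⟩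
      ∑[ y ∈ allBits n ] ∑[ v ∈ allBits n ] ∑[ t ∈ tseqs (n ∸ 2) ] f (Z (atB v) (positions t) k) y
    ≡⟨ ∑-cong (allBits n) (λ y → ∑-comm (allBits n) (tseqs (n ∸ 2)) _) ⟩
      ∑[ y ∈ allBits n ] ∑[ t ∈ tseqs (n ∸ 2) ] ∑[ v ∈ allBits n ] f (Z (atB v) (positions t) k) y
    ≡⟨ ∑-cong (allBits n) (λ y → ∑-cong (tseqs (n ∸ 2)) (λ t → ∑-Z (positions t) k n (λ w → f w y) 2≤k k≤n)) ⟩
      ∑[ y ∈ allBits n ] ∑[ _ ∈ tseqs (n ∸ 2) ] (2 ^ m * ∑[ w ∈ allBits k ] f w y)
    ≡⟨ trans (∑-cong (allBits n) (λ y → ∑-const (tseqs (n ∸ 2)) _)) (∑-*ˡ (allBits n) (length (tseqs (n ∸ 2))) _) ⟩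
      length (tseqs (n ∸ 2)) * ∑[ y ∈ allBits n ] (2 ^ m * ∑[ w ∈ allBits k ] f w y)
    ≡⟨ cong (length (tseqs (n ∸ 2)) *_) (trans (∑-*ˡ (allBits n) (2 ^ m) _) (cong (2 ^ m *_) (∑-comm (allBits n) (allBits k) _))) ⟩
      length (tseqs (n ∸ 2)) * (2 ^ m * ∑[ w ∈ allBits k ] ∑[ y ∈ allBits n ] f w y) ∎
    where
    open ≡-Reasoning
    m : ℕ
    m = n ∸ k
    positions : List ℕ → ℕ → ℕ
    positions t j = atN t (j ∸ 3)

  short-La≤failures : ∀ {k n} → 2 ≤ k → k ≤ n →
    ∑[ o ∈ sample n ] miss (isLong k (La o k)) * 4 ^ k ≤ failures k * length (sample n)
  short-La≤failures {k} {n} 2≤k k≤n = begin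
      ∑[ o ∈ sample n ] short (Zk o k) (Outcome.ys o) * 4 ^ k
    ≡⟨ cong (_* 4 ^ k) (∑-sample-Zk short 2≤k k≤n) ⟩
      Tₙ * (2 ^ m * ∑[ w ∈ allBits k ] ∑[ y ∈ allBits n ] short w y) * 4 ^ k
    ≤⟨ *-monoˡ-≤ (4 ^ k) (*-monoʳ-≤ Tₙ (*-monoʳ-≤ (2 ^ m) (∑-mono (allBits k) (λ w → ∑-miss-prefix w k≤n)))) ⟩
      Tₙ * (2 ^ m * ∑[ w ∈ allBits k ] (2 ^ m * ∑[ y ∈ allBits k ] short w y)) * 4 ^ k
    ≡⟨ cong (λ s → Tₙ * (2 ^ m * s) * 4 ^ k) (∑-*ˡ (allBits k) (2 ^ m) _) ⟩
      Tₙ * (2 ^ m * (2 ^ m * failures k)) * 4 ^ k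
    ≡⟨ regroup Tₙ (2 ^ m) (failures k) (4 ^ k) ⟩
      failures k * (2 ^ m * 2 ^ m * 4 ^ k * Tₙ)
    ≡⟨ cong (λ s → failures k * (s * Tₙ)) 2ᵐ*2ᵐ*4ᵏ≡4ⁿ ⟩
      failures k * (4 ^ n * Tₙ)
    ≡⟨ cong (failures k *_) (sym (length-sample n)) ⟩
      failures k * length (sample n) ∎
    where
    open ≤-Reasoning
    m : ℕ
    m = n ∸ k
    Tₙ : ℕ
    Tₙ = length (tseqs (n ∸ 2))
    short : List Bool → List Bool → ℕ
    short w y = miss (isLong k (lcs w y))
    regroup : ∀ t a f c → t * (a * (a * f)) * c ≡ f * (a * a * c * t)
    regroup = solve-∀
    2ᵐ*2ᵐ*4ᵏ≡4ⁿ : 2 ^ m * 2 ^ m * 4 ^ k ≡ 4 ^ n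
    2ᵐ*2ᵐ*4ᵏ≡4ⁿ = begin-equality
      2 ^ m * 2 ^ m * 4 ^ k  ≡⟨ cong (_* 4 ^ k) (sym ([m*n]^k≡m^k*n^k 2 2 m)) ⟩
      4 ^ m * 4 ^ k          ≡⟨ sym (^-distribˡ-+-* 4 m k) ⟩
      4 ^ (m + k)            ≡⟨ cong (4 ^_) (m∸n+n≡m k≤n) ⟩
      4 ^ n                  ∎

  length-sample>0 : ∀ n → 0 < length (sample n)
  length-sample>0 n = subst (0 <_) (sym (trans (length-sample n) (cong (4 ^ n *_) (length-tseqs (n ∸ 2)))))
    (*-mono-≤ (m^n>0 4 n) (1≤n! (n ∸ 2)))

  bernoulli : ∀ a n → a ^ n * (a + n) ≤ suc a ^ n * a
  bernoulli a zero = ≤-reflexive (cong (_+ 0) (+-identityʳ a))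
  bernoulli a (suc n) = begin
      a * aⁿ * (a + suc n)
    ≡⟨ expand a aⁿ n ⟩
      a * (aⁿ * (a + n)) + aⁿ * a
    ≤⟨ +-monoʳ-≤ (a * (aⁿ * (a + n))) (*-monoʳ-≤ aⁿ (m≤m+n a n)) ⟩
      a * (aⁿ * (a + n)) + aⁿ * (a + n)
    ≡⟨ +-comm (a * (aⁿ * (a + n))) _ ⟩
      suc a * (aⁿ * (a + n))
    ≤⟨ *-monoʳ-≤ (suc a) (bernoulli a n) ⟩
      suc a * (suc a ^ n * a)
    ≡⟨ sym (*-assoc (suc a) (suc a ^ n) a) ⟩
      suc a ^ suc n * a ∎
    where
    open ≤-Reasoning
    aⁿ : ℕ
    aⁿ = a ^ n
    expand : ∀ a p n → a * p * (a + suc n) ≡ a * (p * (a + n)) + p * a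
    expand = solve-∀

  n*aⁿ≤a*bⁿ : ∀ {a b} n → a < b → n * a ^ n ≤ a * b ^ n
  n*aⁿ≤a*bⁿ {a} {b} n a<b = begin
    n * a ^ n        ≤⟨ *-monoˡ-≤ (a ^ n) (m≤n+m n a) ⟩
    (a + n) * a ^ n  ≡⟨ *-comm (a + n) (a ^ n) ⟩
    a ^ n * (a + n)  ≤⟨ bernoulli a n ⟩
    suc a ^ n * a    ≤⟨ *-monoˡ-≤ a (^-monoˡ-≤ n a<b) ⟩
    b ^ n * a        ≡⟨ *-comm (b ^ n) a ⟩
    a * b ^ n        ∎
    where open ≤-Reasoning

  K*n*aⁿ<bⁿ-step : ∀ {a b} K n → a < b → a ≤ n →
    K * (n * a ^ n) < b ^ n → K * (suc n * a ^ suc n) < b ^ suc n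
  K*n*aⁿ<bⁿ-step {a} {b} K n a<b a≤n K*n*aⁿ<bⁿ = begin-strict
    K * (suc n * (a * a ^ n))     ≡⟨ shuffle₁ K n a (a ^ n) ⟩
    (K * a ^ n) * (a + n * a)     ≤⟨ *-monoʳ-≤ (K * a ^ n) a+n*a≤n*b ⟩
    (K * a ^ n) * (n * b)         ≡⟨ shuffle₂ K (a ^ n) n b ⟩
    K * (n * a ^ n) * b           <⟨ *-monoˡ-< b {{>-nonZero (≤-<-trans z≤n a<b)}} K*n*aⁿ<bⁿ ⟩
    b ^ n * b                     ≡⟨ *-comm (b ^ n) b ⟩
    b ^ suc n                     ∎
    where
    open ≤-Reasoning
    a+n*a≤n*b : a + n * a ≤ n * b
    a+n*a≤n*b = ≤-trans (+-monoˡ-≤ (n * a) a≤n) (subst (_≤ n * b) (*-suc n a) (*-monoʳ-≤ n a<b))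
    shuffle₁ : ∀ K n a p → K * (suc n * (a * p)) ≡ (K * p) * (a + n * a)
    shuffle₁ = solve-∀
    shuffle₂ : ∀ K p n b → (K * p) * (n * b) ≡ K * (n * p) * b
    shuffle₂ = solve-∀

  -- Squaring  y aʸ ≤ a bʸ  gives  y² a²ʸ ≤ a² b²ʸ, and y > 2 K a² absorbs the remaining factor.
  K*n*aⁿ<bⁿ-base : ∀ {a b} K y → a < b → 2 * K * a * a < y → K * ((y + y) * a ^ (y + y)) < b ^ (y + y)
  K*n*aⁿ<bⁿ-base {a} {b} K y a<b 2Ka²<y = *-cancelʳ-< y (K * ((y + y) * a ^ (y + y))) (b ^ (y + y)) (begin-strict
    K * ((y + y) * a ^ (y + y)) * y
      ≡⟨ cong (λ t → K * ((y + y) * t) * y) (^-distribˡ-+-* a y y) ⟩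
    K * ((y + y) * (a ^ y * a ^ y)) * y
      ≡⟨ square₁ K y (a ^ y) ⟩
    2 * K * (y * a ^ y) * (y * a ^ y)
      ≤⟨ *-mono-≤ (*-monoʳ-≤ (2 * K) (n*aⁿ≤a*bⁿ y a<b)) (n*aⁿ≤a*bⁿ y a<b) ⟩
    2 * K * (a * b ^ y) * (a * b ^ y)
      ≡⟨ square₂ K a (b ^ y) ⟩
    (2 * K * a * a) * (b ^ y * b ^ y)
      <⟨ *-monoˡ-< (b ^ y * b ^ y) {{m*n≢0 _ _ {{m^n≢0 b y}} {{m^n≢0 b y}}}} 2Ka²<y ⟩
    y * (b ^ y * b ^ y)
      ≡⟨ cong (y *_) (sym (^-distribˡ-+-* b y y)) ⟩
    y * b ^ (y + y)
      ≡⟨ *-comm y _ ⟩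
    b ^ (y + y) * y ∎)
    where
    open ≤-Reasoning
    instance
      b≢0 : NonZero b
      b≢0 = >-nonZero (≤-<-trans z≤n a<b)
    square₁ : ∀ K y p → K * ((y + y) * (p * p)) * y ≡ 2 * K * (y * p) * (y * p)
    square₁ = solve-∀
    square₂ : ∀ K a q → 2 * K * (a * q) * (a * q) ≡ (2 * K * a * a) * (q * q)
    square₂ = solve-∀

  K*n*aⁿ<bⁿ-eventually : ∀ {a b} K → a < b → ∃[ N ] (∀ n → N ≤ n → K * (n * a ^ n) < b ^ n)
  K*n*aⁿ<bⁿ-eventually {a} {b} K a<b = N , λ n N≤n → subst P (m+[n∸m]≡n N≤n) (beyond (n ∸ N))
    where
    P : ℕ → Set
    P n = K * (n * a ^ n) < b ^ n
    y N : ℕ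
    y = suc (2 * K * a * a + a)
    N = y + y
    a≤N : a ≤ N
    a≤N = ≤-trans (m≤n+m a (2 * K * a * a)) (≤-trans (n≤1+n _) (m≤m+n y y))
    beyond : ∀ d → P (N + d)
    beyond zero = subst P (sym (+-identityʳ N)) (K*n*aⁿ<bⁿ-base K y a<b (s≤s (m≤m+n (2 * K * a * a) a)))
    beyond (suc d) = subst P (sym (+-suc N d)) (K*n*aⁿ<bⁿ-step K (N + d) a<b (≤-trans a≤N (m≤m+n N d)) (beyond d))

  ^-ratio-weaken : ∀ {a b u v m x} .{{_ : NonZero b}} → a ≤ b → x ≤ m →
                   u * b ^ m ≤ a ^ m * v → u * b ^ x ≤ a ^ x * v
  ^-ratio-weaken {a} {b} {u} {v} {m} {x} a≤b x≤m ubᵐ≤aᵐv =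
    *-cancelʳ-≤ (u * b ^ x) (a ^ x * v) (b ^ d) {{m^n≢0 b d}} (begin
      u * b ^ x * b ^ d      ≡⟨ *-assoc u (b ^ x) (b ^ d) ⟩
      u * (b ^ x * b ^ d)    ≡⟨ cong (u *_) (sym (^-distribˡ-+-* b x d)) ⟩
      u * b ^ (x + d)        ≡⟨ cong (λ e → u * b ^ e) x+d≡m ⟩
      u * b ^ m              ≤⟨ ubᵐ≤aᵐv ⟩
      a ^ m * v              ≡⟨ cong (λ e → a ^ e * v) (sym x+d≡m) ⟩
      a ^ (x + d) * v        ≡⟨ cong (_* v) (^-distribˡ-+-* a x d) ⟩
      a ^ x * a ^ d * v      ≤⟨ *-monoˡ-≤ v (*-monoʳ-≤ (a ^ x) (^-monoˡ-≤ d a≤b)) ⟩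
      a ^ x * b ^ d * v      ≡⟨ x*y*z≡x*z*y (a ^ x) (b ^ d) v ⟩
      a ^ x * v * b ^ d      ∎)
    where
    open ≤-Reasoning
    d : ℕ
    d = m ∸ x
    x+d≡m : x + d ≡ m
    x+d≡m = m+[n∸m]≡n x≤m
    x*y*z≡x*z*y : ∀ x y z → x * y * z ≡ x * z * y
    x*y*z≡x*z*y = solve-∀

  miss-allB : ∀ {A : Set} (P : A → Bool) xs → miss (allB P xs) ≤ ∑[ x ∈ xs ] miss (P x)
  miss-allB P [] = z≤n
  miss-allB P (x ∷ xs) with P x
  ... | true = miss-allB P xs
  ... | false = s≤s z≤n

  E4-union-bound : ∀ n c B →
    (∀ k → 2 ≤ k → k ≤ n → 45 * n ≤ 100 * k → ∑[ o ∈ sample n ] miss (isLong k (La o k)) * c ≤ B) →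
    ∑[ o ∈ sample n ] miss (E4 n o) * c ≤ suc n * B
  E4-union-bound n c B bound = begin
      ∑[ o ∈ sample n ] miss (E4 n o) * c
    ≤⟨ *-monoˡ-≤ c (∑-mono (sample n) (λ o → miss-allB (holds o) (range 0 n))) ⟩
      ∑[ o ∈ sample n ] ∑[ k ∈ range 0 n ] miss (holds o k) * c
    ≡⟨ trans (cong (_* c) (∑-comm (sample n) (range 0 n) (λ o k → miss (holds o k))))
             (sym (∑-*ʳ (range 0 n) c (λ k → ∑[ o ∈ sample n ] miss (holds o k)))) ⟩
      ∑[ k ∈ range 0 n ] ((∑[ o ∈ sample n ] miss (holds o k)) * c)
    ≤⟨ ∑-mono-All (range-bounded n) (λ {k} → windowed k) ⟩
      ∑[ _ ∈ range 0 n ] B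
    ≡⟨ trans (∑-const (range 0 n) B) (cong (_* B) (length-range 0 n)) ⟩
      suc n * B ∎
    where
    open ≤-Reasoning
    holds : Outcome → ℕ → Bool
    holds o k = not ((2 ≤ᵇ k) ∧ (45 * n ≤ᵇ 100 * k)) ∨ isLong k (La o k)
    nothing-missed : (∑[ _ ∈ sample n ] 0) * c ≤ B
    nothing-missed = subst (λ s → s * c ≤ B) (sym (∑-zero (sample n))) z≤n
    windowed : ∀ k → k ≤ n → (∑[ o ∈ sample n ] miss (holds o k)) * c ≤ B
    windowed k k≤n with 2 ≤ᵇ k in 2≤ᵇk | 45 * n ≤ᵇ 100 * k in window
    ... | false | _ = nothing-missed
    ... | true | false = nothing-missed
    ... | true | true = bound k (≤ᵇ≡true⇒≤ 2 k 2≤ᵇk) k≤n (≤ᵇ≡true⇒≤ (45 * n) (100 * k) window)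

  m*n≤o⇒m≤o/n : ∀ m n {o} .{{_ : NonZero n}} → m * n ≤ o → m ≤ o / n
  m*n≤o⇒m≤o/n m n {o} m*n≤o = subst (_≤ o / n) (m*n/n≡m m n) (/-monoˡ-≤ n m*n≤o)

  suc-n≤2*[n/d]*d : ∀ n d .{{_ : NonZero d}} → 1 ≤ n / d → suc n ≤ 2 * (n / d) * d
  suc-n≤2*[n/d]*d n d 1≤n/d = begin
    suc n                        ≡⟨ cong suc (m≡m%n+[m/n]*n n d) ⟩
    suc (n % d) + n / d * d      ≤⟨ +-monoˡ-≤ (n / d * d) (m%n<n n d) ⟩
    d + n / d * d                ≤⟨ +-monoˡ-≤ (n / d * d) (subst (_≤ n / d * d) (+-identityʳ d) (*-monoˡ-≤ d 1≤n/d)) ⟩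
    n / d * d + n / d * d        ≡⟨ double (n / d) d ⟩
    2 * (n / d) * d              ∎
    where
    open ≤-Reasoning
    double : ∀ x d → x * d + x * d ≡ 2 * x * d
    double = solve-∀

  window⇒x*6≤k : ∀ {n k x} → x * 14 ≤ n → 45 * n ≤ 100 * k → x * 6 ≤ k
  window⇒x*6≤k {n} {k} {x} x*14≤n 45n≤100k = *-cancelˡ-≤ 1400 (begin
      1400 * (x * 6)   ≡⟨ reassoc x ⟩
      600 * (x * 14)   ≤⟨ *-monoʳ-≤ 600 x*14≤n ⟩
      600 * n          ≤⟨ *-monoˡ-≤ n (m≤m+n 600 30) ⟩
      630 * n          ≡⟨ *-assoc 14 45 n ⟩
      14 * (45 * n)    ≤⟨ *-monoʳ-≤ 14 45n≤100k ⟩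
      14 * (100 * k)   ≡⟨ sym (*-assoc 14 100 k) ⟩
      1400 * k         ∎)
    where
    open ≤-Reasoning
    reassoc : ∀ x → 1400 * (x * 6) ≡ 600 * (x * 14)
    reassoc = solve-∀

  module ExponentialMoment (p q : ℕ) (p≤q : p ≤ q) .{{_ : NonZero p}} where

    weight : ℕ → ℕ → ℕ
    weight k L = p ^ (20 * L) * q ^ (20 * (k ∸ L))

    moment : ℕ → ℕ
    moment k = ∑[ w ∈ allBits k ] ∑[ y ∈ allBits k ] weight k (lcs w y)

    private
      20*-split : ∀ {k L} → L ≤ k → 20 * L + 20 * (k ∸ L) ≡ 20 * k
      20*-split {k} {L} L≤k = trans (sym (*-distribˡ-+ 20 L (k ∸ L))) (cong (20 *_) (m+[n∸m]≡n L≤k))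

    weight-antitone : ∀ {k L L′} → L ≤ L′ → L′ ≤ k → weight k L′ ≤ weight k L
    weight-antitone {k} {L} {L′} L≤L′ L′≤k =
      ^*^-shift-≤ (20 * L′) _ (20 * L) _ p≤q (*-monoʳ-≤ 20 L≤L′)
        (trans (20*-split L′≤k) (sym (20*-split (≤-trans L≤L′ L′≤k))))

    weight≤q^20k : ∀ {k L} → L ≤ k → weight k L ≤ q ^ (20 * k)
    weight≤q^20k {k} {L} L≤k =
      subst (weight k L ≤_) (+-identityʳ _) (^*^-shift-≤ (20 * L) _ 0 (20 * k) p≤q z≤n (20*-split L≤k))

    weight-+ : ∀ {a b L M} → L ≤ a → M ≤ b → weight (a + b) (L + M) ≡ weight a L * weight b M
    weight-+ {a} {b} {L} {M} L≤a M≤b = begin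
        p ^ (20 * (L + M)) * q ^ (20 * ((a + b) ∸ (L + M)))
      ≡⟨ cong₂ (λ u v → p ^ u * q ^ v) (*-distribˡ-+ 20 L M)
           (trans (cong (20 *_) (+-∸-interchange L≤a M≤b)) (*-distribˡ-+ 20 (a ∸ L) (b ∸ M))) ⟩
        p ^ (20 * L + 20 * M) * q ^ (20 * (a ∸ L) + 20 * (b ∸ M))
      ≡⟨ cong₂ _*_ (^-distribˡ-+-* p (20 * L) (20 * M)) (^-distribˡ-+-* q (20 * (a ∸ L)) (20 * (b ∸ M))) ⟩
        (p ^ (20 * L) * p ^ (20 * M)) * (q ^ (20 * (a ∸ L)) * q ^ (20 * (b ∸ M)))
      ≡⟨ *-interchange (p ^ (20 * L)) (p ^ (20 * M)) (q ^ (20 * (a ∸ L))) (q ^ (20 * (b ∸ M))) ⟩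
        weight a L * weight b M ∎
      where
      open ≡-Reasoning
      +-∸-interchange : ∀ {L a M b} → L ≤ a → M ≤ b → (a + b) ∸ (L + M) ≡ (a ∸ L) + (b ∸ M)
      +-∸-interchange {a = a} z≤n M≤b = +-∸-assoc a M≤b
      +-∸-interchange (s≤s L≤a) M≤b = +-∸-interchange L≤a M≤b

    moment≤4ᵏq²⁰ᵏ : ∀ k → moment k ≤ 4 ^ k * q ^ (20 * k)
    moment≤4ᵏq²⁰ᵏ k = begin
      moment k
        ≤⟨ ∑-allBits-mono k (λ w ∣w∣≡k → ∑-mono (allBits k) (λ y →
             weight≤q^20k (subst (lcs w y ≤_) ∣w∣≡k (lcs≤length w y)))) ⟩
      ∑[ w ∈ allBits k ] ∑[ y ∈ allBits k ] (q ^ (20 * k))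
        ≡⟨ trans (∑-allBits-const k _) (cong (2 ^ k *_) (∑-allBits-const k _)) ⟩
      2 ^ k * (2 ^ k * q ^ (20 * k))
        ≡⟨ trans (sym (*-assoc (2 ^ k) _ _)) (cong (_* q ^ (20 * k)) (sym ([m*n]^k≡m^k*n^k 2 2 k))) ⟩
      4 ^ k * q ^ (20 * k) ∎
      where open ≤-Reasoning

    weight-lcs-++ : ∀ {b k} a w c y → length a ≡ b → length w ≡ k →
      weight (b + k) (lcs (a ++ w) (c ++ y)) ≤ weight b (lcs a c) * weight k (lcs w y)
    weight-lcs-++ a w c y refl refl = begin
      weight (length a + length w) (lcs (a ++ w) (c ++ y))
        ≤⟨ weight-antitone (lcs-superadditive a w c y)
             (subst (lcs (a ++ w) (c ++ y) ≤_) (length-++ a) (lcs≤length (a ++ w) (c ++ y))) ⟩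
      weight (length a + length w) (lcs a c + lcs w y)
        ≡⟨ weight-+ (lcs≤length a c) (lcs≤length w y) ⟩
      weight (length a) (lcs a c) * weight (length w) (lcs w y) ∎
      where open ≤-Reasoning

    moment-submultiplicative : ∀ b k → moment (b + k) ≤ moment b * moment k
    moment-submultiplicative b k = begin
      moment (b + k)
        ≡⟨ ∑-allBits-+ b k _ ⟩
      ∑[ a ∈ allBits b ] ∑[ w ∈ allBits k ] ∑[ z ∈ allBits (b + k) ] weight (b + k) (lcs (a ++ w) z)
        ≡⟨ ∑-cong (allBits b) (λ a → ∑-cong (allBits k) (λ w → ∑-allBits-+ b k _)) ⟩
      ∑[ a ∈ allBits b ] ∑[ w ∈ allBits k ] ∑[ c ∈ allBits b ] ∑[ y ∈ allBits k ]
        weight (b + k) (lcs (a ++ w) (c ++ y))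
        ≤⟨ ∑-allBits-mono b (λ a ∣a∣ → ∑-allBits-mono k (λ w ∣w∣ → ∑-mono (allBits b) (λ c →
             ∑-mono (allBits k) (λ y → weight-lcs-++ a w c y ∣a∣ ∣w∣)))) ⟩
      ∑[ a ∈ allBits b ] ∑[ w ∈ allBits k ] ∑[ c ∈ allBits b ] ∑[ y ∈ allBits k ]
        (weight b (lcs a c) * weight k (lcs w y))
        ≡⟨ ∑-product (allBits b) (allBits k) (allBits b) (allBits k) _ _ ⟩
      moment b * moment k ∎
      where open ≤-Reasoning

    moment-*ˡ : ∀ m b → moment (m * b) ≤ moment b ^ m
    moment-*ˡ zero b = ≤-refl
    moment-*ˡ (suc m) b = ≤-trans (moment-submultiplicative b (m * b)) (*-monoʳ-≤ (moment b) (moment-*ˡ m b))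

    -- (p^13 q^7)^k is the weight of an LCS of length exactly 0.65 k = 13 k / 20.
    miss-isLong-markov : ∀ {k L} → L ≤ k → miss (isLong k L) * (p ^ 13 * q ^ 7) ^ k ≤ weight k L
    miss-isLong-markov {k} {L} L≤k with isLong k L in isLong≡
    ... | true = z≤n
    ... | false = begin
      1 * (p ^ 13 * q ^ 7) ^ k
        ≡⟨ trans (*-identityˡ _) ([m*n]^k≡m^k*n^k (p ^ 13) (q ^ 7) k) ⟩
      (p ^ 13) ^ k * (q ^ 7) ^ k
        ≡⟨ cong₂ _*_ (^-*-assoc p 13 k) (^-*-assoc q 7 k) ⟩
      p ^ (13 * k) * q ^ (7 * k)
        ≤⟨ ^*^-shift-≤ (13 * k) (7 * k) (20 * L) (20 * (k ∸ L)) p≤q (<⇒≤ 20L<13k)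
             (trans (sym (*-distribʳ-+ k 13 7)) (sym (20*-split L≤k))) ⟩
      weight k L ∎
      where
      open ≤-Reasoning
      20L<13k : 20 * L < 13 * k
      20L<13k = *-cancelˡ-< 5 _ _ (subst₂ _<_ (*-assoc 5 20 L) (*-assoc 5 13 k) (≤ᵇ≡false⇒> (65 * k) (100 * L) isLong≡))

    failures-markov : ∀ k → failures k * (p ^ 13 * q ^ 7) ^ k ≤ moment k
    failures-markov k = begin
      failures k * e ^ k
        ≡⟨ sym (∑-*ʳ (allBits k) (e ^ k) _) ⟩
      ∑[ w ∈ allBits k ] ((∑[ y ∈ allBits k ] miss (isLong k (lcs w y))) * e ^ k)
        ≡⟨ ∑-cong (allBits k) (λ w → sym (∑-*ʳ (allBits k) (e ^ k) _)) ⟩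
      ∑[ w ∈ allBits k ] ∑[ y ∈ allBits k ] (miss (isLong k (lcs w y)) * e ^ k)
        ≤⟨ ∑-allBits-mono k (λ w ∣w∣≡k → ∑-mono (allBits k) (λ y →
             miss-isLong-markov (subst (lcs w y ≤_) ∣w∣≡k (lcs≤length w y)))) ⟩
      moment k ∎
      where
      open ≤-Reasoning
      e : ℕ
      e = p ^ 13 * q ^ 7

    private
      instance
        q≢0 : NonZero q
        q≢0 = >-nonZero (≤-trans (>-nonZero⁻¹ p) p≤q)
        e≢0 : NonZero (p ^ 13 * q ^ 7)
        e≢0 = m*n≢0 (p ^ 13) (q ^ 7) {{m^n≢0 p 13}} {{m^n≢0 q 7}}

    decayBase : ℕ
    decayBase = 4 ^ 6 * (p ^ 13 * q ^ 7) ^ 6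

    decayBase≢0 : NonZero decayBase
    decayBase≢0 = m*n≢0 (4 ^ 6) ((p ^ 13 * q ^ 7) ^ 6) {{m^n≢0 4 6}} {{m^n≢0 (p ^ 13 * q ^ 7) 6}}

    failures-decay-blocks : ∀ m r → r ≤ 5 →
      failures (r + m * 6) * decayBase ^ m ≤ moment 6 ^ m * (q ^ 100 * 4 ^ (r + m * 6))
    failures-decay-blocks m r r≤5 = begin
      failures k * decayBase ^ m
        ≡⟨ cong (failures k *_) ([m*n]^k≡m^k*n^k (4 ^ 6) (e ^ 6) m) ⟩
      failures k * ((4 ^ 6) ^ m * (e ^ 6) ^ m)
        ≤⟨ *-monoʳ-≤ (failures k) (*-monoʳ-≤ ((4 ^ 6) ^ m) e⁶ᵐ≤eᵏ) ⟩
      failures k * ((4 ^ 6) ^ m * e ^ k)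
        ≡⟨ x*[y*z]≡x*z*y (failures k) ((4 ^ 6) ^ m) (e ^ k) ⟩
      failures k * e ^ k * (4 ^ 6) ^ m
        ≤⟨ *-monoˡ-≤ ((4 ^ 6) ^ m) (≤-trans (failures-markov k) (moment-submultiplicative r (m * 6))) ⟩
      moment r * moment (m * 6) * (4 ^ 6) ^ m
        ≤⟨ *-monoˡ-≤ ((4 ^ 6) ^ m) (*-mono-≤ (moment≤4ᵏq²⁰ᵏ r) (moment-*ˡ m 6)) ⟩
      4 ^ r * q ^ (20 * r) * moment 6 ^ m * (4 ^ 6) ^ m
        ≤⟨ *-monoˡ-≤ ((4 ^ 6) ^ m) (*-monoˡ-≤ (moment 6 ^ m)
             (*-monoʳ-≤ (4 ^ r) (^-monoʳ-≤ q (*-monoʳ-≤ 20 r≤5)))) ⟩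
      4 ^ r * q ^ 100 * moment 6 ^ m * (4 ^ 6) ^ m
        ≡⟨ regroup (4 ^ r) (q ^ 100) (moment 6 ^ m) ((4 ^ 6) ^ m) ⟩
      moment 6 ^ m * (q ^ 100 * (4 ^ r * (4 ^ 6) ^ m))
        ≡⟨ cong (λ t → moment 6 ^ m * (q ^ 100 * t)) 4ʳ*[4⁶]ᵐ≡4ᵏ ⟩
      moment 6 ^ m * (q ^ 100 * 4 ^ k) ∎
      where
      open ≤-Reasoning
      k e : ℕ
      k = r + m * 6
      e = p ^ 13 * q ^ 7
      e⁶ᵐ≤eᵏ : (e ^ 6) ^ m ≤ e ^ k
      e⁶ᵐ≤eᵏ = begin
        (e ^ 6) ^ m  ≡⟨ [m^n]^o≡m^[o*n] e 6 m ⟩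
        e ^ (m * 6)  ≤⟨ ^-monoʳ-≤ e (m≤n+m (m * 6) r) ⟩
        e ^ k        ∎
      4ʳ*[4⁶]ᵐ≡4ᵏ : 4 ^ r * (4 ^ 6) ^ m ≡ 4 ^ k
      4ʳ*[4⁶]ᵐ≡4ᵏ = begin-equality
        4 ^ r * (4 ^ 6) ^ m   ≡⟨ cong (4 ^ r *_) ([m^n]^o≡m^[o*n] 4 6 m) ⟩
        4 ^ r * 4 ^ (m * 6)   ≡⟨ sym (^-distribˡ-+-* 4 r (m * 6)) ⟩
        4 ^ k                 ∎
      x*[y*z]≡x*z*y : ∀ x y z → x * (y * z) ≡ x * z * y
      x*[y*z]≡x*z*y = solve-∀
      regroup : ∀ a b c d → a * b * c * d ≡ c * (b * (a * d))
      regroup = solve-∀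

    failures-decay : ∀ k → failures k * decayBase ^ (k / 6) ≤ moment 6 ^ (k / 6) * (q ^ 100 * 4 ^ k)
    failures-decay k =
      subst (λ j → failures j * decayBase ^ (k / 6) ≤ moment 6 ^ (k / 6) * (q ^ 100 * 4 ^ j))
        (sym (m≡m%n+[m/n]*n k 6)) (failures-decay-blocks (k / 6) (k % 6) (≤-pred (m%n<n k 6)))

    module _ (moment₆<decayBase : moment 6 < decayBase) where

      short-La-decay : ∀ {n k x} → 2 ≤ k → k ≤ n → x * 6 ≤ k →
        ∑[ o ∈ sample n ] miss (isLong k (La o k)) * decayBase ^ x ≤ moment 6 ^ x * q ^ 100 * length (sample n)
      short-La-decay {n} {k} {x} 2≤k k≤n x*6≤k =
        *-cancelʳ-≤ (short * decayBase ^ x) (moment 6 ^ x * q ^ 100 * S) (4 ^ k) {{m^n≢0 4 k}} (begin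
          short * decayBase ^ x * 4 ^ k
            ≡⟨ x*y*z≡x*z*y short (decayBase ^ x) (4 ^ k) ⟩
          short * 4 ^ k * decayBase ^ x
            ≤⟨ *-monoˡ-≤ (decayBase ^ x) (short-La≤failures 2≤k k≤n) ⟩
          failures k * S * decayBase ^ x
            ≡⟨ x*y*z≡x*z*y (failures k) S (decayBase ^ x) ⟩
          failures k * decayBase ^ x * S
            ≤⟨ *-monoˡ-≤ S (^-ratio-weaken {u = failures k} {{decayBase≢0}} (<⇒≤ moment₆<decayBase) (m*n≤o⇒m≤o/n x 6 x*6≤k) (failures-decay k)) ⟩
          moment 6 ^ x * (q ^ 100 * 4 ^ k) * S
            ≡⟨ regroup (moment 6 ^ x) (q ^ 100) (4 ^ k) S ⟩
          moment 6 ^ x * q ^ 100 * S * 4 ^ k ∎)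
        where
        open ≤-Reasoning
        short S : ℕ
        short = ∑[ o ∈ sample n ] miss (isLong k (La o k))
        S = length (sample n)
        x*y*z≡x*z*y : ∀ x y z → x * y * z ≡ x * z * y
        x*y*z≡x*z*y = solve-∀
        regroup : ∀ a c f s → a * (c * f) * s ≡ a * c * s * f
        regroup = solve-∀

      -- The block count x = n / 14 serves every k ≥ 0.45 n, since 6 / 14 < 0.45.
      E4-failures : ∀ n → ∑[ o ∈ sample n ] miss (E4 n o) * decayBase ^ (n / 14)
                          ≤ suc n * (moment 6 ^ (n / 14) * q ^ 100 * length (sample n))
      E4-failures n = E4-union-bound n _ _ λ k 2≤k k≤n 45n≤100k →
        short-La-decay {x = n / 14} 2≤k k≤n (window⇒x*6≤k {x = n / 14} (m/n*n≤m n 14) 45n≤100k)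

      E4-failures-rare : ∀ d → ∃[ N ] (∀ n → N ≤ n → ∑[ o ∈ sample n ] miss (E4 n o) * suc d < length (sample n))
      E4-failures-rare d = suc X * 14 , rare
        where
        growth : ∃[ N ] (∀ n → N ≤ n → 28 * q ^ 100 * suc d * (n * moment 6 ^ n) < decayBase ^ n)
        growth = K*n*aⁿ<bⁿ-eventually (28 * q ^ 100 * suc d) moment₆<decayBase
        X : ℕ
        X = proj₁ growth
        K*x*Aˣ<Bˣ : ∀ n → X ≤ n → 28 * q ^ 100 * suc d * (n * moment 6 ^ n) < decayBase ^ n
        K*x*Aˣ<Bˣ = proj₂ growth
        rare : ∀ n → suc X * 14 ≤ n → ∑[ o ∈ sample n ] miss (E4 n o) * suc d < length (sample n)
        rare n [1+X]*14≤n = *-cancelʳ-< (decayBase ^ x) (F * suc d) S (begin-strict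
            F * suc d * decayBase ^ x
          ≡⟨ x*y*z≡x*z*y F (suc d) (decayBase ^ x) ⟩
            F * decayBase ^ x * suc d
          ≤⟨ *-monoˡ-≤ (suc d) (E4-failures n) ⟩
            suc n * (A ^ x * C * S) * suc d
          ≤⟨ *-monoˡ-≤ (suc d) (*-monoˡ-≤ (A ^ x * C * S) (suc-n≤2*[n/d]*d n 14 (≤-trans (s≤s z≤n) 1+X≤x))) ⟩
            2 * x * 14 * (A ^ x * C * S) * suc d
          ≡⟨ regroup x (A ^ x) C S (suc d) ⟩
            28 * C * suc d * (x * A ^ x) * S
          <⟨ *-monoˡ-< S {{>-nonZero (length-sample>0 n)}} (K*x*Aˣ<Bˣ x X≤x) ⟩
            decayBase ^ x * S
          ≡⟨ *-comm (decayBase ^ x) S ⟩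
            S * decayBase ^ x ∎)
          where
          open ≤-Reasoning
          x A C F S : ℕ
          x = n / 14
          A = moment 6
          C = q ^ 100
          F = ∑[ o ∈ sample n ] miss (E4 n o)
          S = length (sample n)
          1+X≤x : suc X ≤ x
          1+X≤x = m*n≤o⇒m≤o/n (suc X) 14 [1+X]*14≤n
          X≤x : X ≤ x
          X≤x = ≤-trans (n≤1+n X) 1+X≤x
          x*y*z≡x*z*y : ∀ x y z → x * y * z ≡ x * z * y
          x*y*z≡x*z*y = solve-∀
          regroup : ∀ x a c s d → 2 * x * 14 * (a * c * s) * d ≡ 28 * c * d * (x * a) * s
          regroup = solve-∀

  countB+∑miss≡length : ∀ {A : Set} (P : A → Bool) xs → countB P xs + ∑[ x ∈ xs ] miss (P x) ≡ length xs
  countB+∑miss≡length P [] = refl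
  countB+∑miss≡length P (x ∷ xs) with P x
  ... | true = cong suc (countB+∑miss≡length P xs)
  ... | false = trans (+-suc (countB P xs) _) (cong suc (countB+∑miss≡length P xs))

open import Data.Rational using (ℚ; 0ℚ; 1ℚ; _<_; _-_; ∣_∣)
open import Data.Bool using (Bool)
open import Data.List using (List; length)
open import Data.Integer as ℤ using (+_; -[1+_]; _⊖_)
import Data.Integer.Properties as ℤ
import Data.Nat as ℕ
import Data.Nat.Properties as ℕ
open import Data.Nat.Coprimality using (Coprime)
open import Data.Rational using (mkℚ; _/_; -_; toℚᵘ; *<*)
open import Data.Rational.Properties using (toℚᵘ-cancel-<; toℚᵘ-homo-∣-∣; toℚᵘ-homo-+; toℚᵘ-homo‿-; toℚᵘ-fromℚᵘ)
open import Data.Rational.Unnormalised as ℚᵘ using (ℚᵘ; mkℚᵘ)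
import Data.Rational.Unnormalised.Properties as ℚᵘ
open import Relation.Binary.PropositionalEquality using (_≡_; refl; sym; trans; cong; cong₂; subst₂; module ≡-Reasoning)
open import Data.Unit using (tt)
open Counting using (∑; miss; countB+∑miss≡length)
open Counting.ExponentialMoment 199 200 (ℕ.n≤1+n 199) using (moment; decayBase; E4-failures-rare)

-- A numerical fact (4096 LCS computations): for k = 6 the normalised moment
-- E[(200/199)^(78 - 20 L)] is about 0.996 < 1.
moment₆<decayBase : moment 6 ℕ.< decayBase
moment₆<decayBase = ℕ.<ᵇ⇒< (moment 6) decayBase tt

-- In ℚᵘ the numerator of  c/(1+l) − 1  is |c − (1+l)| = b.
∣c/[1+l]-1∣<ε : ∀ {c b l num den-1} .{cop : Coprime (suc num) (suc den-1)} →
  c ℕ.+ b ≡ suc l → b ℕ.* suc den-1 ℕ.< suc num ℕ.* suc l →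
  ∣ (+ c) / suc l - 1ℚ ∣ < mkℚ (+ suc num) den-1 cop
∣c/[1+l]-1∣<ε {c} {b} {l} {num} {den-1} c+b≡1+l b*den<num*[1+l] =
  toℚᵘ-cancel-< (ℚᵘ.<-respˡ-≃ (ℚᵘ.≃-sym toℚᵘ-distance) distance<ε)
  where
  distance : ℚᵘ
  distance = ℚᵘ.∣ mkℚᵘ (+ c) l ℚᵘ.+ ℚᵘ.- mkℚᵘ (+ 1) 0 ∣
  toℚᵘ-distance : toℚᵘ ∣ (+ c) / suc l - 1ℚ ∣ ℚᵘ.≃ distance
  toℚᵘ-distance = ℚᵘ.≃-trans (toℚᵘ-homo-∣-∣ ((+ c) / suc l - 1ℚ)) (ℚᵘ.∣-∣-cong (ℚᵘ.≃-trans (toℚᵘ-homo-+ ((+ c) / suc l) (- 1ℚ))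
    (ℚᵘ.+-cong (toℚᵘ-fromℚᵘ (mkℚᵘ (+ c) l)) (toℚᵘ-homo‿- 1ℚ))))
  c≤1+l : c ℕ.≤ suc l
  c≤1+l = subst₂ ℕ._≤_ refl c+b≡1+l (ℕ.m≤m+n c b)
  numerator≡b : ℚᵘ.numerator distance ≡ + b
  numerator≡b = begin
    + ℤ.∣ + c ℤ.* + 1 ℤ.+ -[1+ 0 ] ℤ.* + suc l ∣
      ≡⟨ cong (λ z → + ℤ.∣ z ∣) (trans (cong₂ ℤ._+_ (ℤ.*-identityʳ (+ c)) (ℤ.-1*i≡-i (+ suc l))) (ℤ.m-n≡m⊖n c (suc l))) ⟩
    + ℤ.∣ c ⊖ suc l ∣
      ≡⟨ cong +_ (ℤ.∣⊖∣-≤ c≤1+l) ⟩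
    + (suc l ℕ.∸ c)
      ≡⟨ cong (λ z → + (z ℕ.∸ c)) (sym c+b≡1+l) ⟩
    + (c ℕ.+ b ℕ.∸ c)
      ≡⟨ cong +_ (ℕ.m+n∸m≡n c b) ⟩
    + b ∎
    where open ≡-Reasoning
  denominator≡1+l : ℚᵘ.denominator distance ≡ + suc l
  denominator≡1+l = cong (λ z → + suc z) (ℕ.*-identityʳ l)
  distance<ε : distance ℚᵘ.< mkℚᵘ (+ suc num) den-1
  distance<ε = ℚᵘ.*<* (subst₂ (λ u v → u ℤ.* + suc den-1 ℤ.< + suc num ℤ.* v) (sym numerator≡b) (sym denominator≡1+l)
    (subst₂ ℤ._<_ (ℤ.pos-* b (suc den-1)) (ℤ.pos-* (suc num) (suc l)) (ℤ.+<+ b*den<num*[1+l])))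

∣prob-1∣<ε : ∀ {A : Set} (xs : List A) (P : A → Bool) num den-1 .{cop : Coprime (suc num) (suc den-1)} →
  ∑[ x ∈ xs ] miss (P x) ℕ.* suc den-1 ℕ.< length xs → ∣ prob xs P - 1ℚ ∣ < mkℚ (+ suc num) den-1 cop
∣prob-1∣<ε xs P num den-1 rare with length xs | countB+∑miss≡length P xs
... | zero | _ = ⊥-elim (ℕ.n≮0 rare)
... | suc l | count+misses≡1+l =
  ∣c/[1+l]-1∣<ε {countB P xs} {∑[ x ∈ xs ] miss (P x)} count+misses≡1+l
    (ℕ.<-≤-trans rare (ℕ.m≤n*m (suc l) (suc num)))

lemma4p5 : (ε : ℚ) → 0ℚ < ε → ∃[ N ] ((n : ℕ) → N ≤ n → ∣ PE4 n - 1ℚ ∣ < ε)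
lemma4p5 (mkℚ (+ zero) _ _) (*<* (ℤ.+<+ ()))
lemma4p5 (mkℚ -[1+ _ ] _ _) (*<* ())
lemma4p5 (mkℚ (+ suc num) den-1 _) _ =
  let N , rare = E4-failures-rare moment₆<decayBase den-1
  in N , λ n N≤n → ∣prob-1∣<ε (sample n) (E4 n) num den-1 (rare n N≤n)
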